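{- Let $a \geq 2$ be an integer and define rational numbers $G_{m,a}$ ($m \in \mathbb{N}$) by $$\frac{a t}{e^{(a-1)t} + e^{(a-2)t} + \dots + e^{t} + 1} = \sum_{m=0}^{\infty} G_{m,a} \frac{t^m}{m!}$$ in $\mathbb{Q}[[t]]$. Then for every positive integer $n$, $$G_{n,a} + \sum_{1 \leq k \leq n-1} \binom{n}{k} \frac{a^k}{k+1} G_{n-k,a} = 1.$$ -}

module Defs where

open import Data.Nat as ℕ using (ℕ; zero; suc; _∸_; _!)
open import Data.Nat.Properties using (_!≢0)
open import Data.Integer using (+_)
open import Data.Rational using (ℚ; 0ℚ; _+_; _*_; _/_)

sumℚ : ℕ → (ℕ → ℚ) → ℚ
sumℚ zero    f = 0ℚ
sumℚ (suc n) f = sumℚ n f + f n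

ℕ→ℚ : ℕ → ℚ
ℕ→ℚ n = + n / 1

divFact : ℚ → ℕ → ℚ
divFact x m = x * (+ 1 / (m !))
  where instance _ = m !≢0

-- Formal power series over ℚ, as coefficient sequences: f ↦ Σ f m t^m.
PowerSeries : Set
PowerSeries = ℕ → ℚ

_⊛_ : PowerSeries → PowerSeries → PowerSeries
(f ⊛ g) m = sumℚ (suc m) (λ i → f i * g (m ∸ i))

egf : (ℕ → ℚ) → PowerSeries
egf G m = divFact (G m) m

expSeries : ℕ → PowerSeries
expSeries j m = divFact (ℕ→ℚ (j ℕ.^ m)) m

denomSeries : ℕ → PowerSeries
denomSeries a m = sumℚ a (λ j → expSeries j m)

atSeries : ℕ → PowerSeries
atSeries a zero          = 0ℚ
atSeries a (suc zero)    = ℕ→ℚ a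
atSeries a (suc (suc m)) = 0ℚ

-- G is the sequence G_{m,a} defined by
--   a t / (e^{(a-1)t} + ... + 1) = Σ G m t^m/m!   in ℚ[[t]],
-- i.e. (since the denominator has constant term a ≠ 0, hence is a unit)
--   (Σ G m t^m/m!) · (e^{(a-1)t} + ... + 1) = a t.
IsG : ℕ → (ℕ → ℚ) → Set
IsG a G = ∀ m → (egf G ⊛ denomSeries a) m ≡ atSeries a m
  where open import Relation.Binary.PropositionalEquality using (_≡_)

module Submission where

-- Let H = Σ G m tᵐ/m! and D = Σ_{j<a} e^{jt}, so that H·D = at.  The geometric sum telescopes,
-- D·eᵗ + 1 = D + eᵃᵗ, so multiplying by H gives at·eᵗ + H = at + H·eᵃᵗ.  The constant term of at
-- vanishes, hence G 0 = 0, and comparing coefficients of tⁿ⁺¹ (n ≥ 1) leaves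
--   a/n! = Σ_{k<n} a^{k+1}/(k+1)! · G (n-k)/(n-k)! = a/n! · Σ_{k<n} C(n,k) aᵏ/(k+1) · G (n-k),
-- whose last sum is the left-hand side of the claim.

open import Level using (0ℓ)
open import Algebra.Bundles using (CommutativeRing; CommutativeSemiring; CommutativeMonoid)
import Algebra.Properties.CommutativeSemigroup as CommutativeSemigroupProperties
open import Data.Fin using (Fin; toℕ)
open import Data.Integer as ℤ using (+_)
open import Data.Integer.Properties using (pos-*; pos-+)
open import Data.Nat as ℕ using (ℕ; zero; suc; _∸_; _!; _<_; _≤_; _≥_; _>_; NonZero)
open import Data.Nat using () renaming (_^_ to _^ℕ_)
open import Data.Nat.Combinatorics using (_C_; nCk≡n!/k![n-k]!; k![n∸k]!∣n!)
open import Data.Nat.DivMod using (m/n*n≡m)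
import Data.Nat.Properties as ℕ
open import Data.Nat.Properties using (_!≢0; _!*_!≢0)
open import Data.Nat.Tactic.RingSolver using (solve-∀)
open import Data.Rational using (ℚ; 0ℚ; 1ℚ; _+_; _*_; _/_; toℚᵘ)
open import Data.Rational.Properties
  using (toℚᵘ-injective; toℚᵘ-fromℚᵘ; toℚᵘ-homo-*; toℚᵘ-homo-+;
         +-*-commutativeRing; +-0-group; +-0-commutativeMonoid; *-1-commutativeMonoid;
         +-assoc; +-comm; +-identityˡ; +-identityʳ;
         *-assoc; *-comm; *-identityˡ; *-identityʳ; *-zeroˡ; *-zeroʳ; *-distribˡ-+; *-distribʳ-+)
open import Data.Rational.Solver using (module +-*-Solver)
import Data.Rational.Unnormalised as ℚᵘ
import Data.Rational.Unnormalised.Properties as ℚᵘ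
open import Relation.Binary.PropositionalEquality

open import Defs

open import Algebra.Properties.Group +-0-group using (∙-cancelʳ)
open CommutativeSemigroupProperties (CommutativeMonoid.commutativeSemigroup +-0-commutativeMonoid)
  using () renaming (interchange to +-interchange)
open CommutativeSemigroupProperties (CommutativeMonoid.commutativeSemigroup *-1-commutativeMonoid)
  using (x∙yz≈yx∙z) renaming (interchange to *-interchange)

ℚ-commutativeSemiring : CommutativeSemiring 0ℓ 0ℓ
ℚ-commutativeSemiring = CommutativeRing.commutativeSemiring +-*-commutativeRing

open CommutativeSemiring ℚ-commutativeSemiring using (semiring)
open import Algebra.Definitions.RawMonoid (CommutativeSemiring.+-rawMonoid ℚ-commutativeSemiring)
  using (sum; _×_)
open import Algebra.Properties.Semiring.Exp semiring using (_^_)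
import Algebra.Properties.CommutativeSemiring.Binomial ℚ-commutativeSemiring as Binomial

toℚᵘ-/ : ∀ p d .{{_ : NonZero d}} → toℚᵘ (+ p / d) ℚᵘ.≃ (+ p) ℚᵘ./ d
toℚᵘ-/ p (suc k) = toℚᵘ-fromℚᵘ (ℚᵘ.mkℚᵘ (+ p) k)

/-cross : ∀ p q d e .{{_ : NonZero d}} .{{_ : NonZero e}} →
          p ℕ.* e ≡ q ℕ.* d → + p / d ≡ + q / e
/-cross p q d@(suc _) e@(suc _) eq = toℚᵘ-injective (begin
  toℚᵘ (+ p / d)  ≈⟨ toℚᵘ-/ p d ⟩
  + p ℚᵘ./ d      ≈⟨ ℚᵘ.*≡* (trans (sym (pos-* p e)) (trans (cong +_ eq) (pos-* q d))) ⟩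
  + q ℚᵘ./ e      ≈⟨ toℚᵘ-/ q e ⟨
  toℚᵘ (+ q / e)  ∎)
  where open ℚᵘ.≃-Reasoning

/-*-/ : ∀ p q d e .{{_ : NonZero d}} .{{_ : NonZero e}} →
        (+ p / d) * (+ q / e) ≡ (+ (p ℕ.* q) / (d ℕ.* e)) {{ℕ.m*n≢0 d e}}
/-*-/ p q d@(suc _) e@(suc _) = toℚᵘ-injective (begin
  toℚᵘ ((+ p / d) * (+ q / e))             ≈⟨ toℚᵘ-homo-* (+ p / d) (+ q / e) ⟩
  toℚᵘ (+ p / d) ℚᵘ.* toℚᵘ (+ q / e)      ≈⟨ ℚᵘ.*-cong (toℚᵘ-/ p d) (toℚᵘ-/ q e) ⟩
  (+ p ℚᵘ./ d) ℚᵘ.* (+ q ℚᵘ./ e)          ≡⟨ cong (ℚᵘ._/ (d ℕ.* e)) (sym (pos-* p q)) ⟩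
  + (p ℕ.* q) ℚᵘ./ (d ℕ.* e)              ≈⟨ toℚᵘ-/ (p ℕ.* q) (d ℕ.* e) ⟨
  toℚᵘ (+ (p ℕ.* q) / (d ℕ.* e))          ∎)
  where open ℚᵘ.≃-Reasoning

/-+-/ : ∀ p q d e .{{_ : NonZero d}} .{{_ : NonZero e}} →
        (+ p / d) + (+ q / e) ≡ (+ (p ℕ.* e ℕ.+ q ℕ.* d) / (d ℕ.* e)) {{ℕ.m*n≢0 d e}}
/-+-/ p q d@(suc _) e@(suc _) = toℚᵘ-injective (begin
  toℚᵘ ((+ p / d) + (+ q / e))             ≈⟨ toℚᵘ-homo-+ (+ p / d) (+ q / e) ⟩
  toℚᵘ (+ p / d) ℚᵘ.+ toℚᵘ (+ q / e)      ≈⟨ ℚᵘ.+-cong (toℚᵘ-/ p d) (toℚᵘ-/ q e) ⟩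
  (+ p ℚᵘ./ d) ℚᵘ.+ (+ q ℚᵘ./ e)          ≡⟨ cong (ℚᵘ._/ (d ℕ.* e)) numerator ⟩
  + (p ℕ.* e ℕ.+ q ℕ.* d) ℚᵘ./ (d ℕ.* e)  ≈⟨ toℚᵘ-/ (p ℕ.* e ℕ.+ q ℕ.* d) (d ℕ.* e) ⟨
  toℚᵘ (+ (p ℕ.* e ℕ.+ q ℕ.* d) / (d ℕ.* e)) ∎)
  where
  open ℚᵘ.≃-Reasoning
  numerator : + p ℤ.* + e ℤ.+ + q ℤ.* + d ≡ + (p ℕ.* e ℕ.+ q ℕ.* d)
  numerator = sym (trans (pos-+ (p ℕ.* e) (q ℕ.* d)) (cong₂ ℤ._+_ (pos-* p e) (pos-* q d)))

ℕ→ℚ-homo-+ : ∀ m n → ℕ→ℚ (m ℕ.+ n) ≡ ℕ→ℚ m + ℕ→ℚ n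
ℕ→ℚ-homo-+ m n =
  sym (trans (/-+-/ m n 1 1) (/-cross (m ℕ.* 1 ℕ.+ n ℕ.* 1) (m ℕ.+ n) 1 1 (eq m n)))
  where
  eq : ∀ m n → (m ℕ.* 1 ℕ.+ n ℕ.* 1) ℕ.* 1 ≡ (m ℕ.+ n) ℕ.* 1
  eq = solve-∀

ℕ→ℚ-homo-* : ∀ m n → ℕ→ℚ (m ℕ.* n) ≡ ℕ→ℚ m * ℕ→ℚ n
ℕ→ℚ-homo-* m n = sym (/-*-/ m n 1 1)

ℕ→ℚ-homo-^ : ∀ m n → ℕ→ℚ (m ^ℕ n) ≡ ℕ→ℚ m ^ n
ℕ→ℚ-homo-^ m zero    = refl
ℕ→ℚ-homo-^ m (suc n) =
  trans (ℕ→ℚ-homo-* m (m ^ℕ n)) (cong (_*_ (ℕ→ℚ m)) (ℕ→ℚ-homo-^ m n))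

/≡ℕ→ℚ*1/ : ∀ p d .{{_ : NonZero d}} → + p / d ≡ ℕ→ℚ p * (+ 1 / d)
/≡ℕ→ℚ*1/ p d@(suc _) = sym (trans (/-*-/ p 1 1 d) (/-cross (p ℕ.* 1) p (1 ℕ.* d) d (eq p d)))
  where
  eq : ∀ p d → p ℕ.* 1 ℕ.* d ≡ p ℕ.* (1 ℕ.* d)
  eq = solve-∀

1/-homo-* : ∀ d e .{{_ : NonZero d}} .{{_ : NonZero e}} →
            (+ 1 / (d ℕ.* e)) {{ℕ.m*n≢0 d e}} ≡ (+ 1 / d) * (+ 1 / e)
1/-homo-* d e = sym (/-*-/ 1 1 d e)

/-inverse : ∀ p q .{{_ : NonZero p}} .{{_ : NonZero q}} → (+ p / q) * (+ q / p) ≡ 1ℚ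
/-inverse p@(suc _) q@(suc _) = trans (/-*-/ p q q p) (/-cross (p ℕ.* q) 1 (q ℕ.* p) 1 (eq p q))
  where
  eq : ∀ p q → p ℕ.* q ℕ.* 1 ≡ 1 ℕ.* (q ℕ.* p)
  eq = solve-∀

*-cancelˡ-by-inverse : ∀ c d {x y} → d * c ≡ 1ℚ → c * x ≡ c * y → x ≡ y
*-cancelˡ-by-inverse c d {x} {y} d*c≡1 cx≡cy = begin
  x            ≡⟨ trans (cong (_* x) d*c≡1) (*-identityˡ x) ⟨
  d * c * x    ≡⟨ trans (*-assoc d c x) (cong (_*_ d) cx≡cy) ⟩
  d * (c * y)  ≡⟨ *-assoc d c y ⟨
  d * c * y    ≡⟨ trans (cong (_* y) d*c≡1) (*-identityˡ y) ⟩
  y            ∎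
  where open ≡-Reasoning

1/_! : ℕ → ℚ
1/ m ! = (+ 1 / m !) {{m !≢0}}

nCk*[k!*[n∸k]!]≡n! : ∀ {n k} → k ≤ n → (n C k) ℕ.* (k ! ℕ.* (n ∸ k) !) ≡ n !
nCk*[k!*[n∸k]!]≡n! {n} {k} k≤n =
  trans (cong (ℕ._* (k ! ℕ.* (n ∸ k) !)) (nCk≡n!/k![n-k]! k≤n))
        (m/n*n≡m {{k !* (n ∸ k) !≢0}} (k![n∸k]!∣n! k≤n))

1/k!*1/[n∸k]! : ∀ {n k} → k ≤ n → 1/ k ! * 1/ (n ∸ k) ! ≡ ℕ→ℚ (n C k) * 1/ n !
1/k!*1/[n∸k]! {n} {k} k≤n = begin
  1/ k ! * 1/ (n ∸ k) !
    ≡⟨ /-*-/ 1 1 (k !) ((n ∸ k) !) {{k !≢0}} {{(n ∸ k) !≢0}} ⟩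
  (+ 1 / (k ! ℕ.* (n ∸ k) !)) {{k !* (n ∸ k) !≢0}}
    ≡⟨ /-cross 1 (n C k) (k ! ℕ.* (n ∸ k) !) (n !) {{k !* (n ∸ k) !≢0}} {{n !≢0}}
               (trans (ℕ.*-identityˡ (n !)) (sym (nCk*[k!*[n∸k]!]≡n! k≤n))) ⟩
  (+ (n C k) / n !) {{n !≢0}}
    ≡⟨ /≡ℕ→ℚ*1/ (n C k) (n !) {{n !≢0}} ⟩
  ℕ→ℚ (n C k) * 1/ n !  ∎
  where open ≡-Reasoning

sumℚ-cong : ∀ n {f g : ℕ → ℚ} → (∀ i → i < n → f i ≡ g i) → sumℚ n f ≡ sumℚ n g
sumℚ-cong zero    f≡g = refl
sumℚ-cong (suc n) f≡g =
  cong₂ _+_ (sumℚ-cong n (λ i i<n → f≡g i (ℕ.m<n⇒m<1+n i<n))) (f≡g n ℕ.≤-refl)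

sumℚ-zeros : ∀ n → sumℚ n (λ _ → 0ℚ) ≡ 0ℚ
sumℚ-zeros zero    = refl
sumℚ-zeros (suc n) = trans (+-identityʳ _) (sumℚ-zeros n)

sumℚ-distrib-+ : ∀ n (f g : ℕ → ℚ) → sumℚ n (λ i → f i + g i) ≡ sumℚ n f + sumℚ n g
sumℚ-distrib-+ zero    f g = refl
sumℚ-distrib-+ (suc n) f g = trans (cong (_+ (f n + g n)) (sumℚ-distrib-+ n f g))
  (+-interchange (sumℚ n f) (sumℚ n g) (f n) (g n))

*-distribˡ-sumℚ : ∀ n c (f : ℕ → ℚ) → c * sumℚ n f ≡ sumℚ n (λ i → c * f i)
*-distribˡ-sumℚ zero    c f = *-zeroʳ c
*-distribˡ-sumℚ (suc n) c f =
  trans (*-distribˡ-+ c (sumℚ n f) (f n)) (cong (_+ c * f n) (*-distribˡ-sumℚ n c f))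

*-distribʳ-sumℚ : ∀ n c (f : ℕ → ℚ) → sumℚ n f * c ≡ sumℚ n (λ i → f i * c)
*-distribʳ-sumℚ n c f = trans (*-comm (sumℚ n f) c)
  (trans (*-distribˡ-sumℚ n c f) (sumℚ-cong n (λ i _ → *-comm c (f i))))

sumℚ-head-tail : ∀ n (f : ℕ → ℚ) → sumℚ (suc n) f ≡ f 0 + sumℚ n (λ i → f (suc i))
sumℚ-head-tail zero    f = trans (+-identityˡ (f 0)) (sym (+-identityʳ (f 0)))
sumℚ-head-tail (suc n) f = trans (cong (_+ f (suc n)) (sumℚ-head-tail n f))
  (+-assoc (f 0) (sumℚ n (λ i → f (suc i))) (f (suc n)))

sumℚ-comm : ∀ m n (F : ℕ → ℕ → ℚ) →
            sumℚ m (λ i → sumℚ n (F i)) ≡ sumℚ n (λ j → sumℚ m (λ i → F i j))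
sumℚ-comm zero    n F = sym (sumℚ-zeros n)
sumℚ-comm (suc m) n F = trans (cong (_+ sumℚ n (F m)) (sumℚ-comm m n F))
  (sym (sumℚ-distrib-+ n (λ j → sumℚ m (λ i → F i j)) (F m)))

sumℚ-reverse : ∀ n (f : ℕ → ℚ) → sumℚ n f ≡ sumℚ n (λ i → f (n ∸ suc i))
sumℚ-reverse zero    f = refl
sumℚ-reverse (suc n) f = begin
  sumℚ n f + f n                             ≡⟨ +-comm (sumℚ n f) (f n) ⟩
  f n + sumℚ n f                             ≡⟨ cong (_+_ (f n)) (sumℚ-reverse n f) ⟩
  f n + sumℚ n (λ i → f (n ∸ suc i))         ≡⟨ sumℚ-head-tail n (λ i → f (suc n ∸ suc i)) ⟨
  sumℚ (suc n) (λ i → f (suc n ∸ suc i))     ∎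
  where open ≡-Reasoning

sumℚ-triangle : ∀ m (F : ℕ → ℕ → ℚ) →
                sumℚ (suc m) (λ i → sumℚ (suc (m ∸ i)) (F i)) ≡
                sumℚ (suc m) (λ k → sumℚ (suc k) (λ i → F i (k ∸ i)))
sumℚ-triangle zero    F = refl
sumℚ-triangle (suc m) F = begin
  sumℚ (suc (suc m)) (λ i → sumℚ (suc (suc m ∸ i)) (F i))
    ≡⟨ sumℚ-head-tail (suc m) (λ i → sumℚ (suc (suc m ∸ i)) (F i)) ⟩
  row + sumℚ (suc m) (λ i → sumℚ (suc (m ∸ i)) (F (suc i)))
    ≡⟨ cong (_+_ row) (sumℚ-triangle m (λ i → F (suc i))) ⟩
  row + sumℚ (suc m) (λ k → sumℚ (suc k) (λ i → F (suc i) (k ∸ i)))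
    ≡⟨ cong (_+_ row) (+-identityˡ _) ⟨
  row + (0ℚ + sumℚ (suc m) (λ k → sumℚ (suc k) (λ i → F (suc i) (k ∸ i))))
    ≡⟨ cong (_+_ row) (sumℚ-head-tail (suc m) (λ k → sumℚ k (λ i → F (suc i) (k ∸ suc i)))) ⟨
  row + sumℚ (suc (suc m)) (λ k → sumℚ k (λ i → F (suc i) (k ∸ suc i)))
    ≡⟨ sumℚ-distrib-+ (suc (suc m)) (F 0) (λ k → sumℚ k (λ i → F (suc i) (k ∸ suc i))) ⟨
  sumℚ (suc (suc m)) (λ k → F 0 k + sumℚ k (λ i → F (suc i) (k ∸ suc i)))
    ≡⟨ sumℚ-cong (suc (suc m)) (λ k _ → sumℚ-head-tail k (λ i → F i (k ∸ i))) ⟨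
  sumℚ (suc (suc m)) (λ k → sumℚ (suc k) (λ i → F i (k ∸ i)))  ∎
  where
  open ≡-Reasoning
  row : ℚ
  row = sumℚ (suc (suc m)) (F 0)

sum-toℕ : ∀ n (f : ℕ → ℚ) → sum (λ (k : Fin n) → f (toℕ k)) ≡ sumℚ n f
sum-toℕ zero    f = refl
sum-toℕ (suc n) f =
  trans (cong (_+_ (f 0)) (sum-toℕ n (λ k → f (suc k)))) (sym (sumℚ-head-tail n f))

×≡ℕ→ℚ* : ∀ n x → n × x ≡ ℕ→ℚ n * x
×≡ℕ→ℚ* zero    x = sym (*-zeroˡ x)
×≡ℕ→ℚ* (suc n) x = begin
  x + n × x             ≡⟨ cong₂ _+_ (sym (*-identityˡ x)) (×≡ℕ→ℚ* n x) ⟩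
  1ℚ * x + ℕ→ℚ n * x    ≡⟨ *-distribʳ-+ x 1ℚ (ℕ→ℚ n) ⟨
  (1ℚ + ℕ→ℚ n) * x      ≡⟨ cong (_* x) (ℕ→ℚ-homo-+ 1 n) ⟨
  ℕ→ℚ (suc n) * x       ∎
  where open ≡-Reasoning

binomial-theorem : ∀ n x y →
                   (x + y) ^ n ≡ sumℚ (suc n) (λ k → ℕ→ℚ (n C k) * (x ^ k * y ^ (n ∸ k)))
binomial-theorem n x y = trans (Binomial.theorem n x y)
  (trans (sum-toℕ (suc n) (λ k → (n C k) × (x ^ k * y ^ (n ∸ k))))
         (sumℚ-cong (suc n) (λ k _ → ×≡ℕ→ℚ* (n C k) (x ^ k * y ^ (n ∸ k)))))

-- The ring of formal power series

infixl 6 _⊕_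

_⊕_ : PowerSeries → PowerSeries → PowerSeries
(f ⊕ g) m = f m + g m

⊛-cong : ∀ {f f′ g g′} → f ≗ f′ → g ≗ g′ → f ⊛ g ≗ f′ ⊛ g′
⊛-cong f≗f′ g≗g′ m = sumℚ-cong (suc m) (λ i _ → cong₂ _*_ (f≗f′ i) (g≗g′ (m ∸ i)))

⊛-comm : ∀ f g → f ⊛ g ≗ g ⊛ f
⊛-comm f g m = trans (sumℚ-reverse (suc m) (λ i → f i * g (m ∸ i)))
  (sumℚ-cong (suc m) (λ i i≤m →
    trans (cong (λ j → f (m ∸ i) * g j) (ℕ.m∸[m∸n]≡n (ℕ.≤-pred i≤m))) (*-comm (f (m ∸ i)) (g i))))

⊛-assoc : ∀ f g h → (f ⊛ g) ⊛ h ≗ f ⊛ (g ⊛ h)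
⊛-assoc f g h m = begin
  sumℚ (suc m) (λ k → sumℚ (suc k) (λ i → f i * g (k ∸ i)) * h (m ∸ k))
    ≡⟨ sumℚ-cong (suc m) (λ k _ →
         trans (*-distribʳ-sumℚ (suc k) (h (m ∸ k)) (λ i → f i * g (k ∸ i)))
               (sumℚ-cong (suc k) (λ i i≤k → reassociate k i (ℕ.≤-pred i≤k)))) ⟩
  sumℚ (suc m) (λ k → sumℚ (suc k) (λ i → f i * (g (k ∸ i) * h (m ∸ i ∸ (k ∸ i)))))
    ≡⟨ sumℚ-triangle m (λ i j → f i * (g j * h (m ∸ i ∸ j))) ⟨
  sumℚ (suc m) (λ i → sumℚ (suc (m ∸ i)) (λ j → f i * (g j * h (m ∸ i ∸ j))))
    ≡⟨ sumℚ-cong (suc m) (λ i _ →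
         *-distribˡ-sumℚ (suc (m ∸ i)) (f i) (λ j → g j * h (m ∸ i ∸ j))) ⟨
  sumℚ (suc m) (λ i → f i * sumℚ (suc (m ∸ i)) (λ j → g j * h (m ∸ i ∸ j)))  ∎
  where
  open ≡-Reasoning
  m∸i∸[k∸i]≡m∸k : ∀ {k i} → i ≤ k → m ∸ i ∸ (k ∸ i) ≡ m ∸ k
  m∸i∸[k∸i]≡m∸k {k} {i} i≤k = trans (ℕ.∸-+-assoc m i (k ∸ i)) (cong (m ∸_) (ℕ.m+[n∸m]≡n i≤k))

  reassociate : ∀ k i → i ≤ k →
                f i * g (k ∸ i) * h (m ∸ k) ≡ f i * (g (k ∸ i) * h (m ∸ i ∸ (k ∸ i)))
  reassociate k i i≤k = begin
    f i * g (k ∸ i) * h (m ∸ k)              ≡⟨ *-assoc (f i) (g (k ∸ i)) (h (m ∸ k)) ⟩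
    f i * (g (k ∸ i) * h (m ∸ k))            ≡⟨ cong (λ j → f i * (g (k ∸ i) * h j)) (m∸i∸[k∸i]≡m∸k i≤k) ⟨
    f i * (g (k ∸ i) * h (m ∸ i ∸ (k ∸ i)))  ∎

⊛-distribˡ-⊕ : ∀ f g h → f ⊛ (g ⊕ h) ≗ f ⊛ g ⊕ f ⊛ h
⊛-distribˡ-⊕ f g h m =
  trans (sumℚ-cong (suc m) (λ i _ → *-distribˡ-+ (f i) (g (m ∸ i)) (h (m ∸ i))))
        (sumℚ-distrib-+ (suc m) (λ i → f i * g (m ∸ i)) (λ i → f i * h (m ∸ i)))

sumℚ-⊛ : ∀ n (F : ℕ → PowerSeries) g →
          (λ m → sumℚ n (λ j → F j m)) ⊛ g ≗ λ m → sumℚ n (λ j → (F j ⊛ g) m)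
sumℚ-⊛ n F g m =
  trans (sumℚ-cong (suc m) (λ i _ → *-distribʳ-sumℚ n (g (m ∸ i)) (λ j → F j i)))
        (sumℚ-comm (suc m) n (λ i j → F j i * g (m ∸ i)))

⊛-identityʳ : ∀ f → f ⊛ expSeries 0 ≗ f
⊛-identityʳ f m = begin
  (f ⊛ expSeries 0) m
    ≡⟨ ⊛-comm f (expSeries 0) m ⟩
  (expSeries 0 ⊛ f) m
    ≡⟨ sumℚ-head-tail m (λ i → expSeries 0 i * f (m ∸ i)) ⟩
  1ℚ * f m + sumℚ m (λ i → expSeries 0 (suc i) * f (m ∸ suc i))
    ≡⟨ cong₂ _+_ (*-identityˡ (f m)) (sumℚ-cong m (λ i _ → vanish i)) ⟩
  f m + sumℚ m (λ _ → 0ℚ)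
    ≡⟨ trans (cong (_+_ (f m)) (sumℚ-zeros m)) (+-identityʳ (f m)) ⟩
  f m  ∎
  where
  open ≡-Reasoning
  vanish : ∀ i → expSeries 0 (suc i) * f (m ∸ suc i) ≡ 0ℚ
  vanish i = trans (cong (_* f (m ∸ suc i)) (*-zeroˡ (1/ suc i !))) (*-zeroˡ (f (m ∸ suc i)))

-- Exponential series

expSeries-one : ∀ n → expSeries 1 n ≡ 1/ n !
expSeries-one n = trans (cong (λ p → ℕ→ℚ p * 1/ n !) (ℕ.^-zeroˡ n)) (*-identityˡ (1/ n !))

expSeries-⊛ : ∀ i j → expSeries i ⊛ expSeries j ≗ expSeries (i ℕ.+ j)
expSeries-⊛ i j m = begin
  sumℚ (suc m) (λ k → expSeries i k * expSeries j (m ∸ k))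
    ≡⟨ sumℚ-cong (suc m) (λ k k≤m → term k (ℕ.≤-pred k≤m)) ⟩
  sumℚ (suc m) (λ k → ℕ→ℚ (m C k) * (x ^ k * y ^ (m ∸ k)) * 1/ m !)
    ≡⟨ *-distribʳ-sumℚ (suc m) (1/ m !) (λ k → ℕ→ℚ (m C k) * (x ^ k * y ^ (m ∸ k))) ⟨
  sumℚ (suc m) (λ k → ℕ→ℚ (m C k) * (x ^ k * y ^ (m ∸ k))) * 1/ m !
    ≡⟨ cong (_* 1/ m !) (binomial-theorem m x y) ⟨
  (x + y) ^ m * 1/ m !
    ≡⟨ cong (_* 1/ m !) (trans (ℕ→ℚ-homo-^ (i ℕ.+ j) m) (cong (_^ m) (ℕ→ℚ-homo-+ i j))) ⟨
  expSeries (i ℕ.+ j) m  ∎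
  where
  open ≡-Reasoning
  x y : ℚ
  x = ℕ→ℚ i
  y = ℕ→ℚ j
  term : ∀ k → k ≤ m →
         expSeries i k * expSeries j (m ∸ k) ≡ ℕ→ℚ (m C k) * (x ^ k * y ^ (m ∸ k)) * 1/ m !
  term k k≤m = begin
    ℕ→ℚ (i ^ℕ k) * 1/ k ! * (ℕ→ℚ (j ^ℕ (m ∸ k)) * 1/ (m ∸ k) !)
      ≡⟨ *-interchange (ℕ→ℚ (i ^ℕ k)) (1/ k !) (ℕ→ℚ (j ^ℕ (m ∸ k))) (1/ (m ∸ k) !) ⟩
    ℕ→ℚ (i ^ℕ k) * ℕ→ℚ (j ^ℕ (m ∸ k)) * (1/ k ! * 1/ (m ∸ k) !)
      ≡⟨ cong₂ _*_ (cong₂ _*_ (ℕ→ℚ-homo-^ i k) (ℕ→ℚ-homo-^ j (m ∸ k)))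
                   (1/k!*1/[n∸k]! k≤m) ⟩
    x ^ k * y ^ (m ∸ k) * (ℕ→ℚ (m C k) * 1/ m !)
      ≡⟨ x∙yz≈yx∙z (x ^ k * y ^ (m ∸ k)) (ℕ→ℚ (m C k)) (1/ m !) ⟩
    ℕ→ℚ (m C k) * (x ^ k * y ^ (m ∸ k)) * 1/ m !  ∎

denomSeries-zero : ∀ a → denomSeries a 0 ≡ ℕ→ℚ a
denomSeries-zero zero    = refl
denomSeries-zero (suc a) = begin
  denomSeries a 0 + 1ℚ  ≡⟨ cong (_+ 1ℚ) (denomSeries-zero a) ⟩
  ℕ→ℚ a + 1ℚ            ≡⟨ ℕ→ℚ-homo-+ a 1 ⟨
  ℕ→ℚ (a ℕ.+ 1)         ≡⟨ cong ℕ→ℚ (ℕ.+-comm a 1) ⟩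
  ℕ→ℚ (suc a)           ∎
  where open ≡-Reasoning

denomSeries-telescope : ∀ a →
                        denomSeries a ⊛ expSeries 1 ⊕ expSeries 0 ≗ denomSeries a ⊕ expSeries a
denomSeries-telescope a m = begin
  (denomSeries a ⊛ expSeries 1) m + expSeries 0 m
    ≡⟨ cong (_+ expSeries 0 m) (sumℚ-⊛ a expSeries (expSeries 1) m) ⟩
  sumℚ a (λ j → (expSeries j ⊛ expSeries 1) m) + expSeries 0 m
    ≡⟨ cong (_+ expSeries 0 m) (sumℚ-cong a (λ j _ →
         trans (⊛-comm (expSeries j) (expSeries 1) m) (expSeries-⊛ 1 j m))) ⟩
  sumℚ a (λ j → expSeries (suc j) m) + expSeries 0 m
    ≡⟨ +-comm (sumℚ a (λ j → expSeries (suc j) m)) (expSeries 0 m) ⟩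
  expSeries 0 m + sumℚ a (λ j → expSeries (suc j) m)
    ≡⟨ sumℚ-head-tail a (λ j → expSeries j m) ⟨
  denomSeries a m + expSeries a m  ∎
  where open ≡-Reasoning

atSeries-⊛-suc : ∀ a f n → (atSeries a ⊛ f) (suc n) ≡ ℕ→ℚ a * f n
atSeries-⊛-suc a f n = begin
  (atSeries a ⊛ f) (suc n)
    ≡⟨ sumℚ-head-tail (suc n) (λ i → atSeries a i * f (suc n ∸ i)) ⟩
  0ℚ * f (suc n) + sumℚ (suc n) (λ i → atSeries a (suc i) * f (n ∸ i))
    ≡⟨ cong₂ _+_ (*-zeroˡ (f (suc n))) (sumℚ-head-tail n (λ i → atSeries a (suc i) * f (n ∸ i))) ⟩
  0ℚ + (ℕ→ℚ a * f n + sumℚ n (λ i → 0ℚ * f (n ∸ suc i)))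
    ≡⟨ +-identityˡ _ ⟩
  ℕ→ℚ a * f n + sumℚ n (λ i → 0ℚ * f (n ∸ suc i))
    ≡⟨ cong (_+_ (ℕ→ℚ a * f n))
            (trans (sumℚ-cong n (λ i _ → *-zeroˡ (f (n ∸ suc i)))) (sumℚ-zeros n)) ⟩
  ℕ→ℚ a * f n + 0ℚ
    ≡⟨ +-identityʳ (ℕ→ℚ a * f n) ⟩
  ℕ→ℚ a * f n  ∎
  where open ≡-Reasoning

-- The exponential generating function of G

egf-functional-equation : ∀ a G → IsG a G →
                          atSeries a ⊛ expSeries 1 ⊕ egf G ≗ atSeries a ⊕ egf G ⊛ expSeries a
egf-functional-equation a G isG m = begin
  (atSeries a ⊛ E 1) m + H m
    ≡⟨ cong₂ _+_ (⊛-cong {g = E 1} isG (λ _ → refl) m) (⊛-identityʳ H m) ⟨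
  ((H ⊛ D) ⊛ E 1) m + (H ⊛ E 0) m
    ≡⟨ cong (_+ (H ⊛ E 0) m) (⊛-assoc H D (E 1) m) ⟩
  (H ⊛ (D ⊛ E 1)) m + (H ⊛ E 0) m
    ≡⟨ ⊛-distribˡ-⊕ H (D ⊛ E 1) (E 0) m ⟨
  (H ⊛ (D ⊛ E 1 ⊕ E 0)) m
    ≡⟨ ⊛-cong {f = H} (λ _ → refl) (denomSeries-telescope a) m ⟩
  (H ⊛ (D ⊕ E a)) m
    ≡⟨ ⊛-distribˡ-⊕ H D (E a) m ⟩
  (H ⊛ D) m + (H ⊛ E a) m
    ≡⟨ cong (_+ (H ⊛ E a) m) (isG m) ⟩
  atSeries a m + (H ⊛ E a) m  ∎
  where
  open ≡-Reasoning
  H D : PowerSeries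
  H = egf G
  D = denomSeries a
  E : ℕ → PowerSeries
  E = expSeries

IsG⇒G₀≡0 : ∀ a G → IsG (suc a) G → G 0 ≡ 0ℚ
IsG⇒G₀≡0 a G isG =
  *-cancelˡ-by-inverse (ℕ→ℚ (suc a)) (+ 1 / suc a) (/-inverse 1 (suc a)) (begin
  ℕ→ℚ (suc a) * G 0                  ≡⟨ *-comm (ℕ→ℚ (suc a)) (G 0) ⟩
  G 0 * ℕ→ℚ (suc a)                  ≡⟨ cong₂ _*_ (*-identityʳ (G 0)) (denomSeries-zero (suc a)) ⟨
  egf G 0 * denomSeries (suc a) 0    ≡⟨ +-identityˡ _ ⟨
  (egf G ⊛ denomSeries (suc a)) 0    ≡⟨ isG 0 ⟩
  0ℚ                                 ≡⟨ *-zeroʳ (ℕ→ℚ (suc a)) ⟨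
  ℕ→ℚ (suc a) * 0ℚ                   ∎)
  where open ≡-Reasoning

egf-recurrence : ∀ a G → IsG a G → G 0 ≡ 0ℚ → ∀ n →
                 sumℚ (suc n) (λ k → expSeries a (suc k) * egf G (suc n ∸ k)) ≡
                 divFact (ℕ→ℚ a) (suc n)
egf-recurrence a G isG G₀≡0 n = ∙-cancelʳ (H (suc m)) S (divFact (ℕ→ℚ a) m) (sym (begin
  divFact (ℕ→ℚ a) m + H (suc m)
    ≡⟨ cong (_+ H (suc m))
            (trans (atSeries-⊛-suc a (expSeries 1) m) (cong (_*_ (ℕ→ℚ a)) (expSeries-one m))) ⟨
  (atSeries a ⊛ expSeries 1) (suc m) + H (suc m)
    ≡⟨ egf-functional-equation a G isG (suc m) ⟩
  0ℚ + (H ⊛ expSeries a) (suc m)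
    ≡⟨ trans (+-identityˡ _) (⊛-comm H (expSeries a) (suc m)) ⟩
  (expSeries a ⊛ H) (suc m)
    ≡⟨ sumℚ-head-tail (suc m) (λ k → expSeries a k * H (suc m ∸ k)) ⟩
  1ℚ * H (suc m) + (S + last-term)
    ≡⟨ trans (cong (_+ (S + last-term)) (*-identityˡ (H (suc m))))
             (+-comm (H (suc m)) (S + last-term)) ⟩
  (S + last-term) + H (suc m)
    ≡⟨ cong (λ t → (S + t) + H (suc m)) last-term≡0 ⟩
  (S + 0ℚ) + H (suc m)
    ≡⟨ cong (_+ H (suc m)) (+-identityʳ S) ⟩
  S + H (suc m)  ∎))
  where
  open ≡-Reasoning
  m : ℕ
  m = suc n
  H : PowerSeries
  H = egf G
  S last-term : ℚ
  S = sumℚ m (λ k → expSeries a (suc k) * H (m ∸ k))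
  last-term = expSeries a (suc m) * H (m ∸ m)
  last-term≡0 : last-term ≡ 0ℚ
  last-term≡0 = begin
    expSeries a (suc m) * H (m ∸ m)  ≡⟨ cong (λ i → expSeries a (suc m) * H i) (ℕ.n∸n≡0 m) ⟩
    expSeries a (suc m) * (G 0 * 1ℚ) ≡⟨ cong (λ g → expSeries a (suc m) * (g * 1ℚ)) G₀≡0 ⟩
    expSeries a (suc m) * 0ℚ         ≡⟨ *-zeroʳ (expSeries a (suc m)) ⟩
    0ℚ                               ∎

recurrenceTerm : ℕ → (ℕ → ℚ) → ℕ → ℕ → ℚ
recurrenceTerm a G n k = ℕ→ℚ (n C k) * (+ (a ^ℕ k) / suc k) * G (n ∸ k)

expSeries-*-egf : ∀ a G {n k} → k ≤ n →
                  expSeries a (suc k) * egf G (n ∸ k) ≡ divFact (ℕ→ℚ a) n * recurrenceTerm a G n k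
expSeries-*-egf a G {n} {k} k≤n = begin
  ℕ→ℚ (a ℕ.* a ^ℕ k) * 1/ suc k ! * (g * 1/ (n ∸ k) !)
    ≡⟨ cong₂ (λ u v → u * v * (g * 1/ (n ∸ k) !))
             (ℕ→ℚ-homo-* a (a ^ℕ k)) (1/-homo-* (suc k) (k !) {{_}} {{k !≢0}}) ⟩
  A * P * (I * 1/ k !) * (g * 1/ (n ∸ k) !)
    ≡⟨ solve 6 (λ A P I F g Q → A :* P :* (I :* F) :* (g :* Q) := A :* (P :* I) :* g :* (F :* Q))
             refl A P I (1/ k !) g (1/ (n ∸ k) !) ⟩
  A * (P * I) * g * (1/ k ! * 1/ (n ∸ k) !)
    ≡⟨ cong (_*_ (A * (P * I) * g)) (1/k!*1/[n∸k]! k≤n) ⟩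
  A * (P * I) * g * (ℕ→ℚ (n C k) * 1/ n !)
    ≡⟨ solve 5 (λ A PI g C N → A :* PI :* g :* (C :* N) := A :* N :* (C :* PI :* g))
             refl A (P * I) g (ℕ→ℚ (n C k)) (1/ n !) ⟩
  A * 1/ n ! * (ℕ→ℚ (n C k) * (P * I) * g)
    ≡⟨ cong (λ u → A * 1/ n ! * (ℕ→ℚ (n C k) * u * g)) (/≡ℕ→ℚ*1/ (a ^ℕ k) (suc k)) ⟨
  divFact (ℕ→ℚ a) n * recurrenceTerm a G n k  ∎
  where
  open ≡-Reasoning
  open +-*-Solver
  A P I g : ℚ
  A = ℕ→ℚ a
  P = ℕ→ℚ (a ^ℕ k)
  I = + 1 / suc k
  g = G (n ∸ k)

proposition3 : (a : ℕ) → a ≥ 2 → (G : ℕ → ℚ) → IsG a G →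
  (n : ℕ) → n > 0 →
  G n + sumℚ (n ∸ 1) (λ i → ℕ→ℚ (n C (suc i)) * (+ (a ^ℕ (suc i)) / suc (suc i)) * G (n ∸ (suc i))) ≡ 1ℚ
proposition3 a@(suc a′) _ G isG n@(suc n′) _ =
  *-cancelˡ-by-inverse c (+ (n !) / a) c⁻¹*c≡1 (begin
  c * (G n + sumℚ n′ (λ i → recurrenceTerm a G n (suc i)))
    -- recurrenceTerm a G n 0 computes to 1ℚ * G n.
    ≡⟨ cong (λ t → c * (t + sumℚ n′ (λ i → recurrenceTerm a G n (suc i)))) (*-identityˡ (G n)) ⟨
  c * (recurrenceTerm a G n 0 + sumℚ n′ (λ i → recurrenceTerm a G n (suc i)))
    ≡⟨ cong (_*_ c) (sumℚ-head-tail n′ (recurrenceTerm a G n)) ⟨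
  c * sumℚ n (recurrenceTerm a G n)
    ≡⟨ *-distribˡ-sumℚ n c (recurrenceTerm a G n) ⟩
  sumℚ n (λ k → c * recurrenceTerm a G n k)
    ≡⟨ sumℚ-cong n (λ k k<n → expSeries-*-egf a G (ℕ.<⇒≤ k<n)) ⟨
  sumℚ n (λ k → expSeries a (suc k) * egf G (n ∸ k))
    ≡⟨ egf-recurrence a G isG (IsG⇒G₀≡0 a′ G isG) n′ ⟩
  c
    ≡⟨ *-identityʳ c ⟨
  c * 1ℚ  ∎)
  where
  open ≡-Reasoning
  c : ℚ
  c = divFact (ℕ→ℚ a) n
  c⁻¹*c≡1 : + (n !) / a * c ≡ 1ℚ
  c⁻¹*c≡1 = trans (cong (_*_ (+ (n !) / a)) (sym (/≡ℕ→ℚ*1/ a (n !) {{n !≢0}})))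
                  (/-inverse (n !) a {{n !≢0}})
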